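{- When an adversary presents the vertices of a bipartite graph $G$ one by one (in any order) to the algorithm described in the context, the algorithm produces a proper coloring of $G$, i.e. no two adjacent vertices receive the same color.
   Context: The algorithm uses three pairwise disjoint palettes of colors $\{a_n\}_{n\ge1}$, $\{b_n\}_{n\ge1}$, $\{c_n\}_{n\ge1}$. A vertex has color index $i$ if its color is $a_i$ or $b_i$. For a connected bipartite subgraph $C$, its sides are its two color classes; a color is mixed in $C$ if it is used on vertices of both sides of $C$. A vertex $u$ is universal to a subgraph $C$ if $u$ is adjacent to all vertices of one of the sides of $C$. When a vertex $v$ is presented, let $G_i[v]$ be the subgraph induced by $v$ together with all previously presented vertices colored with a color from $\{a_1,\dots,a_i,b_1,\dots,b_i,c_1,\dots,c_i\}$, let $C_i[v]$ be the connected component of $G_i[v]$ containing $v$, and put $C_0[v]=\{v\}$; for an earlier vertex $u$, $C_i[u]$ refers to this graph as it was when $u$ was presented. The algorithm colors the new vertex $v$ as follows: let $m=\max\{i\ge1: a_i \text{ is mixed in } C_i[v]\}+1$ (with $\max\emptyset=0$); let $I_1,I_2$ be the sides of $C_m[v]$ with $v\in I_1$. If $a_m$ is used on a vertex of $I_2$, color $v$ with $b_m$; else if $c_m$ is used on a vertex of $I_2$, color $v$ with $a_m$; else if there exist $u\in I_1\cup I_2$ and $u'\in I_2$ such that $u$ has color index $j\ge m-\sqrt{2m}+2$ and $u'$ is universal to $C_{j-1}[u]$, color $v$ with $c_m$; otherwise color $v$ with $a_m$. -}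

module Defs where

open import Data.Nat using (ℕ; zero; suc; _+_; _*_; _∸_; _≤_; _<_)
open import Data.Bool using (Bool; true; false; not)
open import Data.Product using (Σ; _×_; _,_; ∃-syntax)
open import Data.Sum using (_⊎_)
open import Relation.Binary.PropositionalEquality using (_≡_; _≢_)
open import Relation.Nullary using (¬_)

-- The three pairwise disjoint palettes {a_n}, {b_n}, {c_n} (n ≥ 1).
data Color : Set where
  a b c : ℕ → Color

level : Color → ℕ
level (a k) = k
level (b k) = k
level (c k) = k

HasIndex : Color → ℕ → Set
HasIndex x j = (x ≡ a j) ⊎ (x ≡ b j)

-- A finite simple graph presented online: vertices 0,1,…,n-1 are presented
-- in this order (the adversary chooses the labelling, hence the order).
-- E is the adjacency relation.
Symmetric : (n : ℕ) → (ℕ → ℕ → Set) → Set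
Symmetric n E = ∀ u v → u < n → v < n → E u v → E v u

Bipartite : (n : ℕ) → (ℕ → ℕ → Set) → Set
Bipartite n E = Σ (ℕ → Bool) λ side → ∀ u v → u < n → v < n → E u v → side u ≢ side v

-- Everything below is relative to the graph E and the colors col w of the
-- vertices (col w is meaningful for the already presented vertices w < v).
module Alg (E : ℕ → ℕ → Set) (col : ℕ → Color) where

  -- vertex set of G_i[v]: v itself and earlier vertices colored from
  -- {a_1..a_i, b_1..b_i, c_1..c_i}
  InG : ℕ → ℕ → ℕ → Set
  InG i v w = (w ≡ v) ⊎ (w < v × (1 ≤ level (col w) × level (col w) ≤ i))

  data Walk (i v : ℕ) : ℕ → Bool → Set where
    here : Walk i v v false
    step : ∀ {u w p} → Walk i v u p → InG i v w → E u w → Walk i v w (not p)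

  -- Side p of C_i[v]: side false (= I_1) contains v, side true is I_2.
  -- (C_i[v] is the component of v in G_i[v]; its vertices are exactly those
  -- reached by a walk from v, and since G is bipartite the parity of such a
  -- walk determines the side.)  For i = 0 this gives C_0[v] = {v}.
  InSide : ℕ → ℕ → Bool → ℕ → Set
  InSide i v p w = Walk i v w p

  InC : ℕ → ℕ → ℕ → Set
  InC i v w = Σ Bool λ p → InSide i v p w

  UsedOn : ℕ → ℕ → Bool → Color → Set
  UsedOn i v p x = ∃[ w ] (w < v × InSide i v p w × col w ≡ x)

  Mixed : ℕ → ℕ → Set
  Mixed i v = UsedOn i v false (a i) × UsedOn i v true (a i)

  -- m = max{ i ≥ 1 : a_i mixed in C_i[v] } + 1   (max ∅ = 0)
  IsM : ℕ → ℕ → Set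
  IsM v m = (1 ≤ m)
          × (∀ i → 1 ≤ i → m ≤ i → ¬ Mixed i v)
          × (2 ≤ m → Mixed (m ∸ 1) v)

  -- u' is universal to C_k[u] (as it was when u was presented):
  -- u' is adjacent to all vertices of one of the sides of C_k[u].
  Universal : ℕ → ℕ → ℕ → Set
  Universal u' k u = (∀ w → InSide k u false w → E u' w)
                   ⊎ (∀ w → InSide k u true w → E u' w)

  -- j ≥ m - √(2m) + 2, written over ℕ:  ((m + 2) ∸ j)² ≤ 2m
  IndexLarge : ℕ → ℕ → Set
  IndexLarge m j = ((m + 2) ∸ j) * ((m + 2) ∸ j) ≤ 2 * m

  CCond : ℕ → ℕ → Set
  CCond v m = ∃[ u ] ∃[ u' ] ∃[ j ]
      ( u < v × InC m v u
      × u' < v × InSide m v true u'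
      × HasIndex (col u) j × IndexLarge m j
      × Universal u' (j ∸ 1) u )

  Rule : ℕ → ℕ → Set
  Rule v m =
      (UsedOn m v true (a m) → col v ≡ b m)
    × (¬ UsedOn m v true (a m) → UsedOn m v true (c m) → col v ≡ a m)
    × (¬ UsedOn m v true (a m) → ¬ UsedOn m v true (c m) → CCond v m → col v ≡ c m)
    × (¬ UsedOn m v true (a m) → ¬ UsedOn m v true (c m) → ¬ CCond v m → col v ≡ a m)

  Follows : ℕ → Set
  Follows v = Σ ℕ λ m → IsM v m × Rule v m

module Submission where

-- Every colour the algorithm gives to a vertex v presented
-- with parameter m lies on level m (it is a_m, b_m or c_m), and each of the
-- three outcomes comes with a guarantee about the far side I_2 of C_m[v]:
--   * v gets a_m only when a_m is not used on I_2,
--   * v gets c_m only when c_m is not used on I_2,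
--   * v gets b_m only when a_m is used on I_2.
-- Let u < v be adjacent and equally coloured.  Then u lies on level m, so u
-- belongs to G_m[v] and, being a neighbour of v, to the far side of C_m[v].
-- If the common colour is a_m or c_m, u itself witnesses that this colour
-- is used on I_2, contradicting the rule.  If it is b_m, the rule applied to
-- u gives a vertex w coloured a_m on the far side of C_m[u]; as G_m[u] is a
-- subgraph of G_m[v], prolonging the edge v–u by the walk from u to w puts w
-- on the near side of C_m[v], so a_m is mixed in C_m[v] — impossible by the
-- maximality in the definition of m.  The rule itself only speaks through
-- conditionals, so the case analysis on its outcome is done classically,
-- inside double negation, which suffices since the goal is a negation.

open import Defs
open import Data.Nat using (ℕ; _<_; _≤_)
open import Data.Nat.Properties using (<-trans; ≤-refl; ≤-reflexive; <-cmp)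
open import Data.Bool using (true; _xor_)
open import Data.Bool.Properties using (xor-identityʳ; not-distribʳ-xor)
open import Data.Product using (_×_; _,_)
open import Data.Sum using (inj₁; inj₂)
open import Relation.Nullary using (¬_; yes; no)
open import Relation.Nullary.Decidable using (¬¬-excluded-middle)
open import Relation.Binary using (tri<; tri≈; tri>)
open import Relation.Binary.PropositionalEquality
  using (_≡_; _≢_; refl; sym; trans; cong; subst)

b-injective : ∀ {k l} → b k ≡ b l → k ≡ l
b-injective refl = refl

a≢b : ∀ {k l} → a k ≢ b l
a≢b ()

c≢b : ∀ {k l} → c k ≢ b l
c≢b ()

module Properness (E : ℕ → ℕ → Set) (col : ℕ → Color) where
  open Alg E col

  EarlyAtLevel : ℕ → ℕ → ℕ → Set
  EarlyAtLevel m v u = u < v × 1 ≤ level (col u) × level (col u) ≤ m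

  subgraph : ∀ {m u v w} → EarlyAtLevel m v u → InG m u w → InG m v w
  subgraph early               (inj₁ refl)             = inj₂ early
  subgraph (u<v , _ , _)        (inj₂ (w<u , lo , hi))  = inj₂ (<-trans w<u u<v , lo , hi)

  concat : ∀ {m u v w p q} → EarlyAtLevel m v u
         → Walk m v u q → Walk m u w p → Walk m v w (q xor p)
  concat {q = q} early v→u here =
    subst (Walk _ _ _) (sym (xor-identityʳ q)) v→u
  concat {q = q} early v→u (step {p = p} u→x x∈G x~w) =
    subst (Walk _ _ _) (not-distribʳ-xor q p)
      (step (concat early v→u u→x) (subgraph early x∈G) x~w)

  on-level : ∀ {m u v} → u < v → 1 ≤ m → level (col u) ≡ m → EarlyAtLevel m v u
  on-level u<v 1≤m lu≡m = u<v , subst (1 ≤_) (sym lu≡m) 1≤m , ≤-reflexive lu≡m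

  far-side : ∀ {m u v} → EarlyAtLevel m v u → E v u → InSide m v true u
  far-side early v~u = step here (inj₂ early) v~u

  data Outcome (v m : ℕ) : Set where
    gotB : UsedOn m v true (a m)   → col v ≡ b m → Outcome v m
    gotA : ¬ UsedOn m v true (a m) → col v ≡ a m → Outcome v m
    gotC : ¬ UsedOn m v true (c m) → col v ≡ c m → Outcome v m

  outcome : ∀ {v m} → Rule v m → ¬ ¬ Outcome v m
  outcome (ifA , ifC , ifCC , otherwise) ¬out = ¬¬-excluded-middle λ where
    (yes usedA) → ¬out (gotB usedA (ifA usedA))
    (no ¬usedA) → ¬¬-excluded-middle λ where
      (yes usedC) → ¬out (gotA ¬usedA (ifC ¬usedA usedC))
      (no ¬usedC) → ¬¬-excluded-middle λ where
        (yes cond) → ¬out (gotC ¬usedC (ifCC ¬usedA ¬usedC cond))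
        (no ¬cond) → ¬out (gotA ¬usedA (otherwise ¬usedA ¬usedC ¬cond))

  b-witness : ∀ {u k} → Follows u → col u ≡ b k → ¬ ¬ UsedOn k u true (a k)
  b-witness (m , _ , rule) u≡bk ¬used = outcome rule λ where
    (gotB used u≡bm) → ¬used (subst (λ l → UsedOn l _ true (a l))
                                    (b-injective (trans (sym u≡bm) u≡bk)) used)
    (gotA _ u≡am)    → a≢b (trans (sym u≡am) u≡bk)
    (gotC _ u≡cm)    → c≢b (trans (sym u≡cm) u≡bk)

  earlier-neighbour : ∀ u v → u < v → E v u → Follows u → Follows v
                    → col u ≢ col v
  earlier-neighbour u v u<v v~u fol-u (m , (1≤m , noMix , _) , rule) u≡v =
    outcome rule λ where
      (gotA ¬usedA v≡am) → ¬usedA (witness v≡am refl)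
      (gotC ¬usedC v≡cm) → ¬usedC (witness v≡cm refl)
      (gotB usedA v≡bm)  → b-witness fol-u (trans u≡v v≡bm) λ where
        (w , w<u , u→w , w≡am) →
          let early = on-level u<v 1≤m (cong level (trans u≡v v≡bm))
              v→w   = concat early (far-side early v~u) u→w
          in noMix m 1≤m ≤-refl ((w , <-trans w<u u<v , v→w , w≡am) , usedA)
    where
    witness : ∀ {x} → col v ≡ x → level x ≡ m → UsedOn m v true x
    witness v≡x lx≡m =
      let u≡x = trans u≡v v≡x
      in u , u<v , far-side (on-level u<v 1≤m (trans (cong level u≡x) lx≡m)) v~u , u≡x

-- Adjacent vertices get distinct colours: order the two endpoints and apply
-- the lemma above; the two endpoints cannot coincide as G has no loops.
claim4 : (n : ℕ) (E : ℕ → ℕ → Set) → Symmetric n E → Bipartite n E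
       → (col : ℕ → Color)
       → (∀ v → v < n → Alg.Follows E col v)
       → ∀ u v → u < n → v < n → E u v → col u ≢ col v
claim4 n E symmetric (_ , properSides) col follows u v u<n v<n u~v
  with <-cmp u v
... | tri< u<v _ _ = Properness.earlier-neighbour E col u v u<v
                       (symmetric u v u<n v<n u~v) (follows u u<n) (follows v v<n)
... | tri> _ _ v<u = λ u≡v → Properness.earlier-neighbour E col v u v<u u~v
                       (follows v v<n) (follows u u<n) (sym u≡v)
... | tri≈ _ refl _ = λ _ → properSides u u u<n u<n u~v refl
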